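{- Let $C_n$ ($n\ge 1$) be the Bethe cacti defined below. Then $M(C_1;x,y)=4x^2y^2$, and for every $n\ge 2$, $$M(C_n;x,y)=8\cdot 3^{n-2}x^2y^2+8\cdot 3^{n-2}x^2y^4+4(2\cdot 3^{n-2}-1)x^4y^4 .$$
   Context: For a finite simple graph $G$ and integers $i,j\ge 1$, let $m_{i,j}(G)$ be the number of edges $uv$ of $G$ with $\{d_u(G),d_v(G)\}=\{i,j\}$, where $d_v(G)$ is the degree of $v$. The $M$-polynomial of $G$ is $M(G;x,y)=\sum_{i\le j} m_{i,j}(G)\,x^iy^j$. Rooted Bethe cacti $D_n$: $D_1$ is a $4$-cycle with one designated vertex, its root. For $n\ge 2$, take a $4$-cycle with vertices $a,b,c,d$ in cyclic order, declare $a$ the root of $D_n$, and take three disjoint copies of $D_{n-1}$, identifying their roots with $b$, $c$, $d$ respectively. Bethe cacti $C_n$: $C_1$ is the $4$-cycle. For $n\ge 2$, $C_n$ is obtained from a $4$-cycle by taking four disjoint copies of $D_{n-1}$ and identifying the root of each copy with a different vertex of the $4$-cycle. -}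

module Defs where

open import Data.Nat using (ℕ; zero; suc; _+_; _≤_; _≤ᵇ_; _≡ᵇ_)
open import Data.Nat.Properties using () renaming (_≟_ to _≟ℕ_)
open import Data.Fin using (Fin; zero; suc) renaming (_≟_ to _≟F_)
open import Data.Fin.Properties using (suc-injective)
open import Data.Bool using (Bool; true; false; if_then_else_; _∧_; _∨_)
open import Data.List using (List; []; _∷_; map; concatMap; length; filter)
open import Data.Nat.ListAction using (sum)
open import Data.List using () renaming (allFin to allFinL)
open import Data.Product using (_×_; _,_; proj₁; proj₂)
open import Data.Empty using (⊥)
open import Relation.Nullary using (Dec; yes; no; ¬_; does)
open import Relation.Binary.Definitions using (DecidableEquality)
open import Relation.Binary.PropositionalEquality using (_≡_; refl; cong)

-- Finite (multi)graphs given by a vertex type with decidable equality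
-- and an explicit list of edges (each edge listed once as a pair).

f0 : ∀ {n} → Fin (suc n)
f0 = zero
f1 : ∀ {n} → Fin (suc (suc n))
f1 = suc zero
f2 : ∀ {n} → Fin (suc (suc (suc n)))
f2 = suc (suc zero)
f3 : ∀ {n} → Fin (suc (suc (suc (suc n))))
f3 = suc (suc (suc zero))

record Graph : Set₁ where
  field
    V    : Set
    _≟V_ : DecidableEquality V
    E    : List (V × V)

open Graph public

degree : (G : Graph) → V G → ℕ
degree G v = sum (map (λ e → ind (proj₁ e) + ind (proj₂ e)) (E G))
  where
  ind : V G → ℕ
  ind u = if does ((_≟V_ G) u v) then 1 else 0

mij : (G : Graph) → ℕ → ℕ → ℕ
mij G i j = length (filter (λ e → test (degree G (proj₁ e)) (degree G (proj₂ e))) (E G))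
  where
  test : (p q : ℕ) → Dec _
  test p q = Data.Bool._≟_ (((p ≡ᵇ i) ∧ (q ≡ᵇ j)) ∨ ((p ≡ᵇ j) ∧ (q ≡ᵇ i))) true

-- Polynomials in x,y with ℕ coefficients, as coefficient functions:
-- P i j = coefficient of x^i y^j.

Poly : Set
Poly = ℕ → ℕ → ℕ

mono : ℕ → ℕ → ℕ → Poly
mono c a b i j = if (i ≡ᵇ a) ∧ (j ≡ᵇ b) then c else 0

infixl 6 _⊕_
_⊕_ : Poly → Poly → Poly
(P ⊕ Q) i j = P i j + Q i j

Mpoly : Graph → Poly
Mpoly G i j = if i ≤ᵇ j then mij G i j else 0

-- Vertices of D_1: cyc k (k = 0..3, in cyclic order, cyc f0 = root).
-- Vertices of D_{n+2}: the root a, and  sub k v  = vertex v of the k-th copy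
-- (k = 0,1,2) of D_{n+1}; the root of copy k is identified with the
-- (k+1)-st cycle vertex (b, c, d), i.e. b = sub f0 (root of D_{n+1}) etc.

data DV : ℕ → Set where
  cyc  : Fin 4 → DV 1
  root : ∀ {n} → DV (suc (suc n))
  sub  : ∀ {n} → Fin 3 → DV (suc n) → DV (suc (suc n))

private
  cyc-inj : ∀ {i j} → cyc i ≡ cyc j → i ≡ j
  cyc-inj refl = refl
  sub-inj₁ : ∀ {n k l} {u v : DV (suc n)} → sub k u ≡ sub l v → k ≡ l
  sub-inj₁ refl = refl
  sub-inj₂ : ∀ {n k l} {u v : DV (suc n)} → sub k u ≡ sub l v → u ≡ v
  sub-inj₂ refl = refl

_≟DV_ : ∀ {n} → DecidableEquality (DV n)
cyc i ≟DV cyc j with i ≟F j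
... | yes refl = yes refl
... | no ne = no (λ eq → ne (cyc-inj eq))
root ≟DV root = yes refl
root ≟DV sub _ _ = no (λ ())
sub _ _ ≟DV root = no (λ ())
sub k u ≟DV sub l v with k ≟F l | u ≟DV v
... | yes refl | yes refl = yes refl
... | no ne | _ = no (λ eq → ne (sub-inj₁ eq))
... | yes _ | no ne = no (λ eq → ne (sub-inj₂ eq))

rootD : ∀ n → DV (suc n)
rootD zero    = cyc zero
rootD (suc n) = root

edgesD : ∀ n → List (DV (suc n) × DV (suc n))
edgesD zero =
  (cyc f0 , cyc f1) ∷ (cyc f1 , cyc f2) ∷ (cyc f2 , cyc f3) ∷ (cyc f3 , cyc f0) ∷ []
edgesD (suc n) =
  (root , b) ∷ (b , c) ∷ (c , d) ∷ (d , root) ∷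
  concatMap (λ k → map (λ e → sub k (proj₁ e) , sub k (proj₂ e)) (edgesD n)) (allFinL 3)
  where
  b c d : DV (suc (suc n))
  b = sub f0 (rootD n)
  c = sub f1 (rootD n)
  d = sub f2 (rootD n)

-- Vertices of C_{n+2}: cs k v = vertex v of the k-th copy (k = 0..3) of
-- D_{n+1}; the root of copy k is identified with the k-th vertex of the
-- central 4-cycle.

data CV : ℕ → Set where
  cyc4 : Fin 4 → CV 1
  cs   : ∀ {n} → Fin 4 → DV (suc n) → CV (suc (suc n))

private
  cyc4-inj : ∀ {i j} → cyc4 i ≡ cyc4 j → i ≡ j
  cyc4-inj refl = refl
  cs-inj₁ : ∀ {n k l} {u v : DV (suc n)} → cs k u ≡ cs l v → k ≡ l
  cs-inj₁ refl = refl
  cs-inj₂ : ∀ {n k l} {u v : DV (suc n)} → cs k u ≡ cs l v → u ≡ v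
  cs-inj₂ refl = refl

_≟CV_ : ∀ {n} → DecidableEquality (CV n)
cyc4 i ≟CV cyc4 j with i ≟F j
... | yes refl = yes refl
... | no ne = no (λ eq → ne (cyc4-inj eq))
cs k u ≟CV cs l v with k ≟F l | u ≟DV v
... | yes refl | yes refl = yes refl
... | no ne | _ = no (λ eq → ne (cs-inj₁ eq))
... | yes _ | no ne = no (λ eq → ne (cs-inj₂ eq))

edgesC : ∀ n → List (CV (suc n) × CV (suc n))
edgesC zero =
  (cyc4 f0 , cyc4 f1) ∷ (cyc4 f1 , cyc4 f2) ∷ (cyc4 f2 , cyc4 f3) ∷ (cyc4 f3 , cyc4 f0) ∷ []
edgesC (suc n) =
  (v f0 , v f1) ∷ (v f1 , v f2) ∷ (v f2 , v f3) ∷ (v f3 , v f0) ∷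
  concatMap (λ k → map (λ e → cs k (proj₁ e) , cs k (proj₂ e)) (edgesD n)) (allFinL 4)
  where
  v : Fin 4 → CV (suc (suc n))
  v k = cs k (rootD n)

-- the empty graph (used only as a dummy value at index 0)
emptyGraph : Graph
emptyGraph = record { V = ⊥ ; _≟V_ = λ () ; E = [] }

D : ℕ → Graph
D zero    = emptyGraph
D (suc n) = record { V = DV (suc n) ; _≟V_ = _≟DV_ ; E = edgesD n }

C : ℕ → Graph
C zero    = emptyGraph
C (suc n) = record { V = CV (suc n) ; _≟V_ = _≟CV_ ; E = edgesC n }

-- Call the "hung degree" of a vertex u of D_n its degree in
-- D_n, plus 2 if u is the root: this is its degree once D_n is glued
-- by its root onto a further 4-cycle, which is how every copy of D_n
-- sits inside D_{n+1} and C_{n+1}.  The root has hung degree 4, and a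
-- vertex of a copy of D_n inside D_{n+1} or C_{n+1} has as degree there
-- the hung degree it had in D_n.
--
-- Let K_n(i,j) be the number of edges of D_n whose ends
-- have hung degrees {i,j}.  The central 4-cycle of D_{n+1} and of C_{n+1}
-- consists of (4,4)-edges, so K_{n+1} = 4[4,4] + 3 K_n and
-- m_{i,j}(C_{n+1}) = 4[4,4] + 4 K_n, with K_1 = 2[2,2] + 2[2,4].

module Submission where

open import Defs
open import Data.Nat using (ℕ; _≤_; _*_; _^_; _∸_)
open import Data.Product using (_×_)
open import Relation.Binary.PropositionalEquality using (_≡_)

open import Data.Nat using (zero; suc; _+_; _≡ᵇ_; _≤ᵇ_; _≤?_; s≤s; z≤n)
open import Data.Nat.Properties
  using (≡ᵇ⇒≡; ≡⇒≡ᵇ; ≤⇒≤ᵇ; ≤ᵇ⇒≤; ≤-refl; ≤-antisym; +-identityʳ; *-identityˡ; *-zeroʳ;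
         *-distribˡ-+; +-comm; +-assoc; *-comm; +-∸-assoc)
open import Data.Fin using (Fin; zero; suc)
open import Data.Fin.Properties using () renaming (_≟_ to _≟F_)
open import Data.Bool using (Bool; true; false; T; if_then_else_; _∧_; _∨_)
open import Data.Bool.Properties using (∨-comm; ∧-comm; T-∧)
import Data.Bool as Bool
open import Data.List using (List; []; _∷_; map; filter; length; _++_; tabulate; concatMap; allFin)
open import Data.List.Properties using (map-++; map-cong; map-tabulate)
open import Data.Nat.ListAction using (sum)
open import Data.Nat.ListAction.Properties using (sum-++)
open import Data.Product using (_,_; proj₁; proj₂)
open import Function using (id; _∘_; Equivalence)
open import Relation.Nullary using (yes; no; does)
open import Relation.Nullary.Decidable using (T?; dec-true; dec-false)
open import Relation.Binary.Definitions using (DecidableEquality)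
open import Relation.Binary.PropositionalEquality using (refl; cong; cong₂; sym; trans; _≢_)
open import Data.Empty using (⊥-elim)
open import Data.Nat.Tactic.RingSolver using (solve-∀)
open Relation.Binary.PropositionalEquality.≡-Reasoning

𝟙 : Bool → ℕ
𝟙 b = if b then 1 else 0

ind : {A : Set} → DecidableEquality A → A → A → ℕ
ind _≟_ u v = 𝟙 (does (u ≟ v))

ind-refl : {A : Set} (_≟_ : DecidableEquality A) (u : A) → ind _≟_ u u ≡ 1
ind-refl _≟_ u with u ≟ u
... | yes _ = refl
... | no u≢u = ⊥-elim (u≢u refl)

ind-≢ : {A : Set} (_≟_ : DecidableEquality A) {u v : A} → u ≢ v → ind _≟_ u v ≡ 0
ind-≢ _≟_ {u} {v} u≢v rewrite dec-false (u ≟ v) u≢v = refl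

kronecker-sum : ∀ {m} (k : Fin m) (d : ℕ) → sum (map (λ l → ind _≟F_ l k * d) (allFin m)) ≡ d
kronecker-sum k d = trans (cong sum (map-tabulate id (λ l → ind _≟F_ l k * d))) (tabulated k)
  where
  zeros : ∀ n → sum (tabulate {n = n} (λ _ → 0)) ≡ 0
  zeros zero = refl
  zeros (suc n) = zeros n
  tabulated : ∀ {n} (k : Fin n) → sum (tabulate (λ l → ind _≟F_ l k * d)) ≡ d
  tabulated {suc n} zero = trans (cong (1 * d +_) (zeros n))
    (trans (+-identityʳ _) (*-identityˡ d))
  tabulated (suc k) = tabulated k


Edges : Set → Set
Edges A = List (A × A)

-- the degree of v in the edge list es (this is `degree` of Defs)
deg : {A : Set} → DecidableEquality A → Edges A → A → ℕ
deg _≟_ es v = sum (map (λ e → ind _≟_ (proj₁ e) v + ind _≟_ (proj₂ e) v) es)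

mapE : {A B : Set} → (A → B) → Edges A → Edges B
mapE f = map (λ e → f (proj₁ e) , f (proj₂ e))

square : {A : Set} → (Fin 4 → A) → Edges A
square w = (w zero , w (suc zero)) ∷ (w (suc zero) , w (suc (suc zero)))
  ∷ (w (suc (suc zero)) , w (suc (suc (suc zero)))) ∷ (w (suc (suc (suc zero))) , w zero) ∷ []

copies : {I A B : Set} → (I → A → B) → List I → Edges A → Edges B
copies tag ks es = concatMap (λ l → mapE (tag l) es) ks

deg-++ : {A : Set} (_≟_ : DecidableEquality A) (xs ys : Edges A) (v : A) →
  deg _≟_ (xs ++ ys) v ≡ deg _≟_ xs v + deg _≟_ ys v
deg-++ {A} _≟_ xs ys v = trans (cong sum (map-++ f xs ys)) (sum-++ (map f xs) (map f ys))
  where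
  f : A × A → ℕ
  f e = ind _≟_ (proj₁ e) v + ind _≟_ (proj₂ e) v

deg-copies-sum : {I A B : Set} (_≟_ : DecidableEquality B) (tag : I → A → B)
  (ks : List I) (es : Edges A) (v : B) →
  deg _≟_ (copies tag ks es) v ≡ sum (map (λ l → deg _≟_ (mapE (tag l) es) v) ks)
deg-copies-sum _≟_ tag [] es v = refl
deg-copies-sum _≟_ tag (l ∷ ks) es v =
  trans (deg-++ _≟_ (mapE (tag l) es) (copies tag ks es) v)
        (cong (deg _≟_ (mapE (tag l) es) v +_) (deg-copies-sum _≟_ tag ks es v))

deg-map-absent : {A B : Set} (_≟_ : DecidableEquality B) (f : A → B) (w : B) →
  (∀ a → ind _≟_ (f a) w ≡ 0) → (es : Edges A) → deg _≟_ (mapE f es) w ≡ 0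
deg-map-absent _≟_ f w absent [] = refl
deg-map-absent _≟_ f w absent ((a , b) ∷ es)
  rewrite absent a | absent b = deg-map-absent _≟_ f w absent es

deg-square : {A : Set} (_≟_ : DecidableEquality A) (w : Fin 4 → A) (v : A) →
  deg _≟_ (square w) v ≡ 2 * sum (map (λ l → ind _≟_ (w l) v) (allFin 4))
deg-square _≟_ w v = twice (at zero) (at (suc zero)) (at (suc (suc zero))) (at (suc (suc (suc zero))))
  where
  twice : ∀ a b c d → a + b + (b + c + (c + d + (d + a + 0))) ≡ 2 * (a + (b + (c + (d + 0))))
  twice = solve-∀
  at : Fin 4 → ℕ
  at l = ind _≟_ (w l) v

-- Copies tagged injectively by Fin m: a tagged vertex tag k u sees only
-- its own copy, where it has the degree of u.
module Tagged {m : ℕ} {A B : Set} (_≟A_ : DecidableEquality A) (_≟B_ : DecidableEquality B)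
  (tag : Fin m → A → B) (tag-injective : ∀ {l k a u} → tag l a ≡ tag k u → l ≡ k × a ≡ u) where

  ind-tag : ∀ l k a u → ind _≟B_ (tag l a) (tag k u) ≡ ind _≟F_ l k * ind _≟A_ a u
  ind-tag l k a u with l ≟F k | a ≟A u
  ... | yes refl | yes refl = ind-refl _≟B_ (tag l a)
  ... | yes refl | no a≢u   = ind-≢ _≟B_ (a≢u ∘ proj₂ ∘ tag-injective)
  ... | no l≢k   | _        = ind-≢ _≟B_ (l≢k ∘ proj₁ ∘ tag-injective)

  point-sum : ∀ a u k → sum (map (λ l → ind _≟B_ (tag l a) (tag k u)) (allFin m)) ≡ ind _≟A_ a u
  point-sum a u k = trans (cong sum (map-cong (λ l → ind-tag l k a u) (allFin m)))
                          (kronecker-sum k (ind _≟A_ a u))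

  deg-tag : ∀ l k u (es : Edges A) → deg _≟B_ (mapE (tag l) es) (tag k u) ≡ ind _≟F_ l k * deg _≟A_ es u
  deg-tag l k u [] = sym (*-zeroʳ (ind _≟F_ l k))
  deg-tag l k u ((a , b) ∷ es) = begin
    ind _≟B_ (tag l a) (tag k u) + ind _≟B_ (tag l b) (tag k u) + deg _≟B_ (mapE (tag l) es) (tag k u)
      ≡⟨ cong₂ _+_ (cong₂ _+_ (ind-tag l k a u) (ind-tag l k b u)) (deg-tag l k u es) ⟩
    δ * ind _≟A_ a u + δ * ind _≟A_ b u + δ * deg _≟A_ es u
      ≡⟨ cong (_+ δ * deg _≟A_ es u) (sym (*-distribˡ-+ δ _ _)) ⟩
    δ * (ind _≟A_ a u + ind _≟A_ b u) + δ * deg _≟A_ es u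
      ≡⟨ sym (*-distribˡ-+ δ _ _) ⟩
    δ * deg _≟A_ ((a , b) ∷ es) u ∎
    where
    δ : ℕ
    δ = ind _≟F_ l k

  deg-copies : ∀ k u (es : Edges A) → deg _≟B_ (copies tag (allFin m) es) (tag k u) ≡ deg _≟A_ es u
  deg-copies k u es = begin
    deg _≟B_ (copies tag (allFin m) es) (tag k u)
      ≡⟨ deg-copies-sum _≟B_ tag (allFin m) es (tag k u) ⟩
    sum (map (λ l → deg _≟B_ (mapE (tag l) es) (tag k u)) (allFin m))
      ≡⟨ cong sum (map-cong (λ l → deg-tag l k u es) (allFin m)) ⟩
    sum (map (λ l → ind _≟F_ l k * deg _≟A_ es u) (allFin m))
      ≡⟨ kronecker-sum k (deg _≟A_ es u) ⟩
    deg _≟A_ es u ∎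


sub-injective : ∀ {n l k} {a u : DV (suc n)} → sub l a ≡ sub k u → l ≡ k × a ≡ u
sub-injective refl = refl , refl

cs-injective : ∀ {n l k} {a u : DV (suc n)} → cs l a ≡ cs k u → l ≡ k × a ≡ u
cs-injective refl = refl , refl

module SubD {n : ℕ} = Tagged (_≟DV_ {suc n}) (_≟DV_ {suc (suc n)}) sub sub-injective
module SubC {n : ℕ} = Tagged (_≟DV_ {suc n}) (_≟CV_ {suc (suc n)}) cs cs-injective

-- By definition edgesD (suc n) is  square (cornerD n)  followed by
-- copies sub (allFin 3) (edgesD n), and likewise for edgesC.
cornerD : ∀ n → Fin 4 → DV (suc (suc n))
cornerD n zero    = root
cornerD n (suc l) = sub l (rootD n)

isRoot : ∀ n → DV (suc n) → ℕ
isRoot n = ind _≟DV_ (rootD n)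

-- the degree of u once D_{n+1} is glued by its root onto a 4-cycle
hungDegree : ∀ n → DV (suc n) → ℕ
hungDegree n u = degree (D (suc n)) u + 2 * isRoot n u

degD-sub : ∀ n k u → degree (D (suc (suc n))) (sub k u) ≡ hungDegree n u
degD-sub n k u = begin
  deg _≟DV_ (square (cornerD n) ++ copies sub (allFin 3) (edgesD n)) (sub k u)
    ≡⟨ deg-++ _≟DV_ (square (cornerD n)) (copies sub (allFin 3) (edgesD n)) (sub k u) ⟩
  deg _≟DV_ (square (cornerD n)) (sub k u) + deg _≟DV_ (copies sub (allFin 3) (edgesD n)) (sub k u)
    ≡⟨ cong₂ _+_ (trans (deg-square _≟DV_ (cornerD n) (sub k u))
                        (cong (2 *_) (SubD.point-sum (rootD n) u k)))
                 (SubD.deg-copies k u (edgesD n)) ⟩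
  2 * isRoot n u + degree (D (suc n)) u
    ≡⟨ +-comm (2 * isRoot n u) (degree (D (suc n)) u) ⟩
  hungDegree n u ∎

-- the root of D_{n+2} lies only on the central 4-cycle
degD-root : ∀ n → degree (D (suc (suc n))) root ≡ 2
degD-root n = begin
  deg _≟DV_ (square (cornerD n) ++ copies sub (allFin 3) (edgesD n)) root
    ≡⟨ deg-++ _≟DV_ (square (cornerD n)) (copies sub (allFin 3) (edgesD n)) root ⟩
  2 + deg _≟DV_ (copies sub (allFin 3) (edgesD n)) root
    ≡⟨ cong (2 +_) (deg-copies-sum _≟DV_ sub (allFin 3) (edgesD n) root) ⟩
  2 + sum (map (λ l → deg _≟DV_ (mapE (sub l) (edgesD n)) root) (allFin 3))
    ≡⟨ cong (λ xs → 2 + sum xs)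
            (map-cong (λ l → deg-map-absent _≟DV_ (sub l) root (λ _ → refl) (edgesD n)) (allFin 3)) ⟩
  2 ∎

degC : ∀ n k u → degree (C (suc (suc n))) (cs k u) ≡ hungDegree n u
degC n k u = begin
  deg _≟CV_ (square corner ++ copies cs (allFin 4) (edgesD n)) (cs k u)
    ≡⟨ deg-++ _≟CV_ (square corner) (copies cs (allFin 4) (edgesD n)) (cs k u) ⟩
  deg _≟CV_ (square corner) (cs k u) + deg _≟CV_ (copies cs (allFin 4) (edgesD n)) (cs k u)
    ≡⟨ cong₂ _+_ (trans (deg-square _≟CV_ corner (cs k u))
                        (cong (2 *_) (SubC.point-sum (rootD n) u k)))
                 (SubC.deg-copies k u (edgesD n)) ⟩
  2 * isRoot n u + degree (D (suc n)) u
    ≡⟨ +-comm (2 * isRoot n u) (degree (D (suc n)) u) ⟩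
  hungDegree n u ∎
  where
  corner : Fin 4 → CV (suc (suc n))
  corner l = cs l (rootD n)

-- roots have hung degree 4: degree 2 in D_1 and D_{n+2}, plus 2
hung-root : ∀ n → hungDegree n (rootD n) ≡ 4
hung-root zero    = refl
hung-root (suc n) = cong (_+ 2) (degD-root n)

hung-sub : ∀ n k u → hungDegree (suc n) (sub k u) ≡ hungDegree n u
hung-sub n k u = trans (+-identityʳ _) (degD-sub n k u)


hasDegrees : ℕ → ℕ → ℕ → ℕ → Bool
hasDegrees i j p q = ((p ≡ᵇ i) ∧ (q ≡ᵇ j)) ∨ ((p ≡ᵇ j) ∧ (q ≡ᵇ i))

hasDegrees-sym : ∀ i j p q → hasDegrees i j p q ≡ hasDegrees i j q p
hasDegrees-sym i j p q =
  trans (∨-comm ((p ≡ᵇ i) ∧ (q ≡ᵇ j)) _) (cong₂ _∨_ (∧-comm (p ≡ᵇ j) _) (∧-comm (p ≡ᵇ i) _))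

count : {A : Set} → (A → Bool) → List A → ℕ
count g []       = 0
count g (x ∷ xs) = 𝟙 (g x) + count g xs

length-filter : {A : Set} (g : A → Bool) (xs : List A) →
  length (filter (λ x → g x Bool.≟ true) xs) ≡ count g xs
length-filter g [] = refl
length-filter g (x ∷ xs) with g x
... | true  = cong suc (length-filter g xs)
... | false = length-filter g xs

edgeCount : {A : Set} → (A → ℕ) → Edges A → ℕ → ℕ → ℕ
edgeCount d es i j = count (λ e → hasDegrees i j (d (proj₁ e)) (d (proj₂ e))) es

mij-edgeCount : ∀ G i j → mij G i j ≡ edgeCount (degree G) (E G) i j
mij-edgeCount G i j = length-filter (λ e → hasDegrees i j (degree G (proj₁ e)) (degree G (proj₂ e))) (E G)

edgeCount-++ : {A : Set} (d : A → ℕ) (xs ys : Edges A) (i j : ℕ) →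
  edgeCount d (xs ++ ys) i j ≡ edgeCount d xs i j + edgeCount d ys i j
edgeCount-++ d [] ys i j = refl
edgeCount-++ d ((a , b) ∷ xs) ys i j =
  trans (cong (t +_) (edgeCount-++ d xs ys i j)) (sym (+-assoc t (edgeCount d xs i j) (edgeCount d ys i j)))
  where
  t : ℕ
  t = 𝟙 (hasDegrees i j (d a) (d b))

edgeCount-map : {A B : Set} (d : B → ℕ) (d′ : A → ℕ) (f : A → B) → (∀ a → d (f a) ≡ d′ a) →
  (es : Edges A) (i j : ℕ) → edgeCount d (mapE f es) i j ≡ edgeCount d′ es i j
edgeCount-map d d′ f same [] i j = refl
edgeCount-map d d′ f same ((a , b) ∷ es) i j =
  cong₂ _+_ (cong 𝟙 (cong₂ (hasDegrees i j) (same a) (same b))) (edgeCount-map d d′ f same es i j)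

edgeCount-copies : {I A B : Set} (d : B → ℕ) (d′ : A → ℕ) (tag : I → A → B) →
  (∀ l a → d (tag l a) ≡ d′ a) → (ks : List I) (es : Edges A) (i j : ℕ) →
  edgeCount d (copies tag ks es) i j ≡ length ks * edgeCount d′ es i j
edgeCount-copies d d′ tag same [] es i j = refl
edgeCount-copies d d′ tag same (l ∷ ks) es i j =
  trans (edgeCount-++ d (mapE (tag l) es) (copies tag ks es) i j)
        (cong₂ _+_ (edgeCount-map d d′ (tag l) (same l) es i j) (edgeCount-copies d d′ tag same ks es i j))

edgeCount-square : {A : Set} (d : A → ℕ) (w : Fin 4 → A) (c : ℕ) → (∀ l → d (w l) ≡ c) →
  (i j : ℕ) → edgeCount d (square w) i j ≡ 4 * 𝟙 (hasDegrees i j c c)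
edgeCount-square d w c same i j
  rewrite same zero | same (suc zero) | same (suc (suc zero)) | same (suc (suc (suc zero))) = refl


hungCount : ℕ → ℕ → ℕ → ℕ
hungCount n = edgeCount (hungDegree n) (edgesD n)

corners-D : ∀ n l → hungDegree (suc n) (cornerD n l) ≡ 4
corners-D n zero    = hung-root (suc n)
corners-D n (suc l) = trans (hung-sub n l (rootD n)) (hung-root n)

hungCount-suc : ∀ n i j → hungCount (suc n) i j ≡ 4 * 𝟙 (hasDegrees i j 4 4) + 3 * hungCount n i j
hungCount-suc n i j =
  trans (edgeCount-++ (hungDegree (suc n)) (square (cornerD n)) (copies sub (allFin 3) (edgesD n)) i j)
        (cong₂ _+_ (edgeCount-square (hungDegree (suc n)) (cornerD n) 4 (corners-D n) i j)
                   (edgeCount-copies (hungDegree (suc n)) (hungDegree n) sub (hung-sub n) (allFin 3) (edgesD n) i j))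

mij-C : ∀ n i j → mij (C (suc (suc n))) i j ≡ 4 * 𝟙 (hasDegrees i j 4 4) + 4 * hungCount n i j
mij-C n i j =
  trans (mij-edgeCount (C (suc (suc n))) i j)
  (trans (edgeCount-++ d (square corner) (copies cs (allFin 4) (edgesD n)) i j)
         (cong₂ _+_ (edgeCount-square d corner 4 (λ l → trans (degC n l (rootD n)) (hung-root n)) i j)
                    (edgeCount-copies d (hungDegree n) cs (degC n) (allFin 4) (edgesD n) i j)))
  where
  d : CV (suc (suc n)) → ℕ
  d = degree (C (suc (suc n)))
  corner : Fin 4 → CV (suc (suc n))
  corner l = cs l (rootD n)

-- the number of (4,4)-edges of D_{n+1}
fourFour : ℕ → ℕ
fourFour zero    = 0
fourFour (suc n) = 4 + 3 * fourFour n

fourFour-closed : ∀ n → fourFour n + 1 ≡ 2 * 3 ^ n ∸ 1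
fourFour-closed n = trans (sym (+-∸-assoc (fourFour n) (s≤s (z≤n {1})))) (cong (_∸ 1) (plus-two n))
  where
  plus-two : ∀ n → fourFour n + 2 ≡ 2 * 3 ^ n
  plus-two zero    = refl
  plus-two (suc n) = trans (step (fourFour n)) (trans (cong (3 *_) (plus-two n)) (swap (3 ^ n)))
    where
    step : ∀ s → 4 + 3 * s + 2 ≡ 3 * (s + 2)
    step = solve-∀
    swap : ∀ p → 3 * (2 * p) ≡ 2 * (3 * p)
    swap = solve-∀

hungCount-closed : ∀ n i j → hungCount n i j
  ≡ 𝟙 (hasDegrees i j 2 2) * (2 * 3 ^ n) + 𝟙 (hasDegrees i j 2 4) * (2 * 3 ^ n)
    + 𝟙 (hasDegrees i j 4 4) * fourFour n
hungCount-closed zero i j rewrite hasDegrees-sym i j 4 2 =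
  base (𝟙 (hasDegrees i j 2 2)) (𝟙 (hasDegrees i j 2 4)) (𝟙 (hasDegrees i j 4 4))
  where
  base : ∀ x y z → y + (x + (x + (y + 0))) ≡ x * 2 + y * 2 + z * 0
  base = solve-∀
hungCount-closed (suc n) i j = begin
  hungCount (suc n) i j
    ≡⟨ hungCount-suc n i j ⟩
  4 * z + 3 * hungCount n i j
    ≡⟨ cong (λ k → 4 * z + 3 * k) (hungCount-closed n i j) ⟩
  4 * z + 3 * (x * (2 * 3 ^ n) + y * (2 * 3 ^ n) + z * fourFour n)
    ≡⟨ step x y z (3 ^ n) (fourFour n) ⟩
  x * (2 * 3 ^ suc n) + y * (2 * 3 ^ suc n) + z * fourFour (suc n) ∎
  where
  x y z : ℕ
  x = 𝟙 (hasDegrees i j 2 2)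
  y = 𝟙 (hasDegrees i j 2 4)
  z = 𝟙 (hasDegrees i j 4 4)
  step : ∀ x y z p s → 4 * z + 3 * (x * (2 * p) + y * (2 * p) + z * s)
                       ≡ x * (2 * (3 * p)) + y * (2 * (3 * p)) + z * (4 + 3 * s)
  step = solve-∀

mij-C-closed : ∀ n i j → mij (C (suc (suc n))) i j
  ≡ 𝟙 (hasDegrees i j 2 2) * (8 * 3 ^ n) + 𝟙 (hasDegrees i j 2 4) * (8 * 3 ^ n)
    + 𝟙 (hasDegrees i j 4 4) * (4 * (2 * 3 ^ n ∸ 1))
mij-C-closed n i j = begin
  mij (C (suc (suc n))) i j
    ≡⟨ mij-C n i j ⟩
  4 * z + 4 * hungCount n i j
    ≡⟨ cong (λ k → 4 * z + 4 * k) (hungCount-closed n i j) ⟩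
  4 * z + 4 * (x * (2 * 3 ^ n) + y * (2 * 3 ^ n) + z * fourFour n)
    ≡⟨ collect x y z (3 ^ n) (fourFour n) ⟩
  x * (8 * 3 ^ n) + y * (8 * 3 ^ n) + z * (4 * (fourFour n + 1))
    ≡⟨ cong (λ k → x * (8 * 3 ^ n) + y * (8 * 3 ^ n) + z * (4 * k)) (fourFour-closed n) ⟩
  x * (8 * 3 ^ n) + y * (8 * 3 ^ n) + z * (4 * (2 * 3 ^ n ∸ 1)) ∎
  where
  x y z : ℕ
  x = 𝟙 (hasDegrees i j 2 2)
  y = 𝟙 (hasDegrees i j 2 4)
  z = 𝟙 (hasDegrees i j 4 4)
  collect : ∀ x y z p s → 4 * z + 4 * (x * (2 * p) + y * (2 * p) + z * s)
                          ≡ x * (8 * p) + y * (8 * p) + z * (4 * (s + 1))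
  collect = solve-∀


𝟙-gate : ∀ b a → 𝟙 b * a ≡ (if b then a else 0)
𝟙-gate true  a = +-identityʳ a
𝟙-gate false a = refl

gate-+ : ∀ b x y → (if b then x + y else 0) ≡ (if b then x else 0) + (if b then y else 0)
gate-+ true  x y = refl
gate-+ false x y = refl

≡ᵇ-comm : ∀ m n → (m ≡ᵇ n) ≡ (n ≡ᵇ m)
≡ᵇ-comm zero    zero    = refl
≡ᵇ-comm zero    (suc n) = refl
≡ᵇ-comm (suc m) zero    = refl
≡ᵇ-comm (suc m) (suc n) = ≡ᵇ-comm m n

∨-absorb : ∀ x y → (T y → T x) → x ∨ y ≡ x
∨-absorb true  y     y⇒x = refl
∨-absorb false true  y⇒x = ⊥-elim (y⇒x _)
∨-absorb false false y⇒x = refl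

-- For ordered pairs p ≤ q and i ≤ j, the swapped match (p,q) = (j,i)
-- forces i = j = p = q, so it is subsumed by the direct match.
swapped⇒direct : ∀ {p q i j} → p ≤ q → i ≤ j → T ((p ≡ᵇ j) ∧ (q ≡ᵇ i)) → T ((p ≡ᵇ i) ∧ (q ≡ᵇ j))
swapped⇒direct {p} {q} {i} {j} p≤q i≤j t
  with ≡ᵇ⇒≡ p j (proj₁ (Equivalence.to T-∧ t)) | ≡ᵇ⇒≡ q i (proj₂ (Equivalence.to T-∧ t))
... | refl | refl with ≤-antisym i≤j p≤q
... | refl = Equivalence.from T-∧ (≡⇒≡ᵇ i i refl , ≡⇒≡ᵇ i i refl)

hasDegrees-ordered : ∀ {p q i j} → p ≤ q → i ≤ j → hasDegrees i j p q ≡ (i ≡ᵇ p) ∧ (j ≡ᵇ q)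
hasDegrees-ordered {p} {q} {i} {j} p≤q i≤j =
  trans (∨-absorb ((p ≡ᵇ i) ∧ (q ≡ᵇ j)) _ (swapped⇒direct p≤q i≤j))
        (cong₂ _∧_ (≡ᵇ-comm p i) (≡ᵇ-comm q j))

monomial-ordered : ∀ {p q i j} → p ≤ q → T ((i ≡ᵇ p) ∧ (j ≡ᵇ q)) → i ≤ j
monomial-ordered {p} {q} {i} {j} p≤q t
  with ≡ᵇ⇒≡ i p (proj₁ (Equivalence.to T-∧ t)) | ≡ᵇ⇒≡ j q (proj₂ (Equivalence.to T-∧ t))
... | refl | refl = p≤q

edge-monomial : ∀ {p q} → p ≤ q → ∀ i j a →
  (if i ≤ᵇ j then 𝟙 (hasDegrees i j p q) * a else 0) ≡ mono a p q i j
edge-monomial {p} {q} p≤q i j a with i ≤? j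
... | yes i≤j rewrite dec-true (T? (i ≤ᵇ j)) (≤⇒≤ᵇ i≤j) | hasDegrees-ordered p≤q i≤j =
  𝟙-gate ((i ≡ᵇ p) ∧ (j ≡ᵇ q)) a
... | no i≰j rewrite dec-false (T? (i ≤ᵇ j)) (i≰j ∘ ≤ᵇ⇒≤ i j)
                   | dec-false (T? ((i ≡ᵇ p) ∧ (j ≡ᵇ q))) (i≰j ∘ monomial-ordered p≤q) = refl

M-C₁ : ∀ i j → Mpoly (C 1) i j ≡ mono 4 2 2 i j
M-C₁ i j = trans (cong (λ t → if i ≤ᵇ j then t else 0)
                       (trans (mij-edgeCount (C 1) i j) (*-comm 4 (𝟙 (hasDegrees i j 2 2)))))
                 (edge-monomial (≤-refl {2}) i j 4)

M-Cₙ₊₂ : ∀ n i j → Mpoly (C (suc (suc n))) i j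
  ≡ (mono (8 * 3 ^ n) 2 2 ⊕ mono (8 * 3 ^ n) 2 4 ⊕ mono (4 * (2 * 3 ^ n ∸ 1)) 4 4) i j
M-Cₙ₊₂ n i j = begin
  gate (mij (C (suc (suc n))) i j)
    ≡⟨ cong gate (mij-C-closed n i j) ⟩
  gate (X + Y + Z)
    ≡⟨ trans (gate-+ (i ≤ᵇ j) (X + Y) Z) (cong (_+ gate Z) (gate-+ (i ≤ᵇ j) X Y)) ⟩
  gate X + gate Y + gate Z
    ≡⟨ cong₂ _+_ (cong₂ _+_ (edge-monomial (≤-refl {2}) i j (8 * 3 ^ n))
                            (edge-monomial (s≤s (s≤s (z≤n {2}))) i j (8 * 3 ^ n)))
                 (edge-monomial (≤-refl {4}) i j (4 * (2 * 3 ^ n ∸ 1))) ⟩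
  (mono (8 * 3 ^ n) 2 2 ⊕ mono (8 * 3 ^ n) 2 4 ⊕ mono (4 * (2 * 3 ^ n ∸ 1)) 4 4) i j ∎
  where
  gate : ℕ → ℕ
  gate t = if i ≤ᵇ j then t else 0
  X Y Z : ℕ
  X = 𝟙 (hasDegrees i j 2 2) * (8 * 3 ^ n)
  Y = 𝟙 (hasDegrees i j 2 4) * (8 * 3 ^ n)
  Z = 𝟙 (hasDegrees i j 4 4) * (4 * (2 * 3 ^ n ∸ 1))

theorem3p2 : (∀ i j → Mpoly (C 1) i j ≡ mono 4 2 2 i j)
    × (∀ n → 2 ≤ n → ∀ i j →
    Mpoly (C n) i j
    ≡ (mono (8 * 3 ^ (n ∸ 2)) 2 2
    ⊕ mono (8 * 3 ^ (n ∸ 2)) 2 4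
    ⊕ mono (4 * (2 * 3 ^ (n ∸ 2) ∸ 1)) 4 4) i j)
theorem3p2 = M-C₁ , λ { (suc (suc n)) (s≤s (s≤s z≤n)) → M-Cₙ₊₂ n }
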